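{- Let $f\in\mathcal{G}_1$ be $n$-ary, given by $f=2x_1\cdots x_n\left(\sum_{i=1}^n a_ix_i^2+\sum_{i=1}^n b_ix_i+c\right)$ with $a_i,b_i\in\{0,1\}$, $c\in\{0,1,2,3\}$, such that $a_i=0$ for all $i$ and $b_j=1$ for some $j$. Let $K=\{j\mid b_j=1\}$. Then: (i) if $K=\{1,\dots,n\}$ and $c\in\{0,1\}$, then $f=2t_n$ or $f=2s_n$; (ii) if $1\le|K|<n$, then $2v_n\in C(f)$; (iii) if $1\le|K|<n$ and $|K|$ is even, then $C(f)=C(2v_n)$ or $C(f)=C(2v_n)\vee C(2r_n)$; (iv) if $1\le|K|<n$ and $|K|$ is odd, then $C(f)=C(2u_n)$ or $C(f)=C(2p_n)$.
   Context: Arithmetic is in $\mathbb{Z}_8$. $\mathcal{G}_1$ is the set of all operations (of any arity $n\ge1$) given by polynomials $2x_1\cdots x_n(\sum_{i=1}^n a_ix_i^2+\sum_{i=1}^n b_ix_i+c)$ with $a_i,b_i\in\{0,1\}$ and $c\in\{0,1,2,3\}$. For an operation $g$, $C(g)$ denotes the clone on $\mathbb{Z}_8$ generated by $g$, the binary addition and all unary constant operations; $C\vee D$ is the smallest clone containing clones $C,D$. Polynomials: $r_n=x_1\cdots x_n$; $t_n=x_1\cdots x_n(x_1+\dots+x_n)$ for $n$ even and $x_1\cdots x_n(x_1+\dots+x_n+1)$ for $n$ odd; $s_n=x_1\cdots x_n(x_1+\dots+x_n)$ for $n$ odd and $x_1\cdots x_n(x_1+\dots+x_n+1)$ for $n$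 even; $p_n=x_1^2x_2\cdots x_n$; $u_n=x_1\cdots x_n(x_1+1)$; $v_n=x_1\cdots x_n(x_1+x_2)$ ($n\ge2$). -}

module Defs where

open import Data.Nat as ℕ using (ℕ; zero; suc; _≤_; _<_; z≤n; s≤s)
open import Data.Nat.DivMod using (_mod_)
open import Data.Nat.Properties using (≤-trans; <⇒≤)
open import Data.Fin using (Fin; toℕ; fromℕ<)
open import Data.Bool using (Bool; true; false; if_then_else_)
open import Data.Product using (_×_; _,_)
open import Data.Sum using (_⊎_)
open import Relation.Binary.PropositionalEquality using (_≡_)

Z8 : Set
Z8 = Fin 8

infixl 6 _⊕_
infixl 7 _⊗_

_⊕_ : Z8 → Z8 → Z8
a ⊕ b = (toℕ a ℕ.+ toℕ b) mod 8

_⊗_ : Z8 → Z8 → Z8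
a ⊗ b = (toℕ a ℕ.* toℕ b) mod 8

lit : ℕ → Z8
lit k = k mod 8

bit : Bool → Z8
bit true  = lit 1
bit false = lit 0

Op : ℕ → Set
Op m = (Fin m → Z8) → Z8

Σ[_] : ∀ {m} → (Fin m → Z8) → Z8
Σ[_] {zero}  f = lit 0
Σ[_] {suc m} f = f Data.Fin.zero ⊕ Σ[ (λ i → f (Data.Fin.suc i)) ]

Π[_] : ∀ {m} → (Fin m → Z8) → Z8
Π[_] {zero}  f = lit 1
Π[_] {suc m} f = f Data.Fin.zero ⊗ Π[ (λ i → f (Data.Fin.suc i)) ]

twice : ∀ {m} → Op m → Op m
twice g x = lit 2 ⊗ g x

addOp : Op 2
addOp x = x Data.Fin.zero ⊕ x (Data.Fin.suc Data.Fin.zero)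

OpSet : Set₁
OpSet = (m : ℕ) → Op m → Set

-- the clone generated by S: contains S and all projections, is closed
-- under composition, and (operations being functions) under pointwise equality.
data ⟨_⟩ (S : OpSet) : OpSet where
  gen  : ∀ {m} {f : Op m} → S m f → ⟨ S ⟩ m f
  proj : ∀ {m} (i : Fin m) → ⟨ S ⟩ m (λ x → x i)
  comp : ∀ {k m} {f : Op k} {gs : Fin k → Op m} →
         ⟨ S ⟩ k f → (∀ i → ⟨ S ⟩ m (gs i)) →
         ⟨ S ⟩ m (λ x → f (λ i → gs i x))
  ext  : ∀ {m} {f g : Op m} → (∀ x → f x ≡ g x) → ⟨ S ⟩ m g → ⟨ S ⟩ m f

data GensC {n : ℕ} (g : Op n) : OpSet where
  isG     : GensC g n g
  isAdd   : GensC g 2 addOp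
  isConst : (c : Z8) → GensC g 1 (λ _ → c)

C : ∀ {n} → Op n → OpSet
C g = ⟨ GensC g ⟩

_∨_ : OpSet → OpSet → OpSet
A ∨ B = ⟨ (λ m f → A m f ⊎ B m f) ⟩

_≐_ : OpSet → OpSet → Set
A ≐ B = ∀ m (f : Op m) → (A m f → B m f) × (B m f → A m f)

G1op : (n : ℕ) → (a b : Fin n → Bool) → Fin 4 → Op n
G1op n a b c x =
  lit 2 ⊗ Π[ x ] ⊗
    (Σ[ (λ i → bit (a i) ⊗ x i ⊗ x i) ] ⊕ Σ[ (λ i → bit (b i) ⊗ x i) ] ⊕ lit (toℕ c))

even : ℕ → Bool
even zero          = true
even (suc zero)    = false
even (suc (suc n)) = even n

count : ∀ {n} → (Fin n → Bool) → ℕ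
count {zero}  b = 0
count {suc n} b = (if b Data.Fin.zero then 1 else 0) ℕ.+ count (λ i → b (Data.Fin.suc i))

r : (n : ℕ) → Op n
r n x = Π[ x ]

t : (n : ℕ) → Op n
t n x = Π[ x ] ⊗ (Σ[ x ] ⊕ (if even n then lit 0 else lit 1))

s : (n : ℕ) → Op n
s n x = Π[ x ] ⊗ (Σ[ x ] ⊕ (if even n then lit 1 else lit 0))

p : (n : ℕ) → 1 ≤ n → Op n
p n h x = x (fromℕ< h) ⊗ Π[ x ]

u : (n : ℕ) → 1 ≤ n → Op n
u n h x = Π[ x ] ⊗ (x (fromℕ< h) ⊕ lit 1)

v : (n : ℕ) → 2 ≤ n → Op n
v n h x = Π[ x ] ⊗ (x (fromℕ< (<⇒≤ h)) ⊕ x (fromℕ< h))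

twoLe : ∀ {k n} → 1 ≤ k → k < n → 2 ≤ n
twoLe h1 h2 = ≤-trans (s≤s h1) h2

lit4 : ℕ → Fin 4
lit4 k = k mod 4

{-# OPTIONS --safe #-}
-- With all aᵢ = 0 the operation is f = 2x₁⋯xₙ(Σ_{i∈K} xᵢ + c). Write D i j = 2x₁⋯xₙ(xᵢ − xⱼ) and
-- F = 4x₁⋯xₙ. A clone containing +, the constants and 2vₙ contains F (replace x₁ by 2x₁ and use
-- 4a² = 4a) and every D i j (relabel the variables, replace xⱼ by 3xⱼ and multiply by 3), hence
-- every Σ βᵢ·(D i 1) + z·F. Conversely, for j ∈ K and l ∉ K, f minus f with xⱼ and xₗ exchanged
-- is D j l, from which 2vₙ is recovered: this is (ii). Modulo those combinations f is
-- |K|·2pₙ + c·2rₙ, and 2·2pₙ = 2·2rₙ = F, so only the parities of |K| and c matter: f is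
-- congruent to 0, 2rₙ, 2pₙ or 2pₙ + 2rₙ = 2uₙ. Since 2pₙ and 2uₙ give back 2vₙ by symmetrising
-- in x₁ and x₂, this yields (iii) and (iv); (i) is a direct computation.
module Submission where

open import Defs
open import Algebra.Bundles using (CommutativeSemiring)
open import Algebra.Structures.Biased using (isCommutativeMonoidˡ; isCommutativeSemiringˡ)
open import Data.Fin using (Fin; zero; suc; toℕ)
open import Data.Fin.Properties using (all?; _≟_; toℕ-injective; toℕ-fromℕ<)
open import Data.Fin.Permutation using (Permutation′; _⟨$⟩ʳ_; _⟨$⟩ˡ_; inverseˡ; transpose)
open import Data.Bool using (Bool; true; false; if_then_else_)
open import Data.Nat as ℕ using (ℕ; zero; suc; 2+; _≤_; _<_; s≤s; z≤n)
open import Data.Nat.DivMod using (_%_; _/_; %-distribˡ-+; m%n<n; m∣n⇒o%n%m≡o%m)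
open import Data.Nat.Divisibility using (divides)
open import Data.Vec.Functional using (updateAt; removeAt; _∷_; [])
open import Data.Vec.Functional.Properties using (updateAt-updates; updateAt-minimal)
open import Data.Product using (_×_; _,_; ∃; proj₁; proj₂)
open import Data.Sum using (_⊎_; inj₁; inj₂; [_,_]) renaming (map to ⊎-map; swap to ⊎-swap)
open import Level using (0ℓ)
open import Relation.Binary.PropositionalEquality
  using (_≡_; _≢_; refl; sym; trans; cong; cong₂; subst; subst₂; module ≡-Reasoning)
open import Relation.Binary.PropositionalEquality.Algebra using (isMagma)
open import Relation.Nullary using (Dec; yes; no)
open import Relation.Nullary.Decidable using (from-yes; _⊎-dec_; dec-true; dec-false)

-- ℤ₈ as a commutative semiring

⊕-assoc : ∀ a b c → (a ⊕ b) ⊕ c ≡ a ⊕ (b ⊕ c)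
⊕-assoc = from-yes (all? λ a → all? λ b → all? λ c → (a ⊕ b) ⊕ c ≟ a ⊕ (b ⊕ c))

⊕-comm : ∀ a b → a ⊕ b ≡ b ⊕ a
⊕-comm = from-yes (all? λ a → all? λ b → a ⊕ b ≟ b ⊕ a)

⊕-identityˡ : ∀ a → lit 0 ⊕ a ≡ a
⊕-identityˡ = from-yes (all? λ a → lit 0 ⊕ a ≟ a)

⊗-assoc : ∀ a b c → (a ⊗ b) ⊗ c ≡ a ⊗ (b ⊗ c)
⊗-assoc = from-yes (all? λ a → all? λ b → all? λ c → (a ⊗ b) ⊗ c ≟ a ⊗ (b ⊗ c))

⊗-comm : ∀ a b → a ⊗ b ≡ b ⊗ a
⊗-comm = from-yes (all? λ a → all? λ b → a ⊗ b ≟ b ⊗ a)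

⊗-identityˡ : ∀ a → lit 1 ⊗ a ≡ a
⊗-identityˡ = from-yes (all? λ a → lit 1 ⊗ a ≟ a)

⊗-distribʳ-⊕ : ∀ a b c → (b ⊕ c) ⊗ a ≡ b ⊗ a ⊕ c ⊗ a
⊗-distribʳ-⊕ = from-yes (all? λ a → all? λ b → all? λ c → (b ⊕ c) ⊗ a ≟ b ⊗ a ⊕ c ⊗ a)

⊗-zeroˡ : ∀ a → lit 0 ⊗ a ≡ lit 0
⊗-zeroˡ = from-yes (all? λ a → lit 0 ⊗ a ≟ lit 0)

Z8-commutativeSemiring : CommutativeSemiring 0ℓ 0ℓ
Z8-commutativeSemiring = record
  { Carrier = Z8 ; _≈_ = _≡_ ; _+_ = _⊕_ ; _*_ = _⊗_ ; 0# = lit 0 ; 1# = lit 1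
  ; isCommutativeSemiring = isCommutativeSemiringˡ record
    { +-isCommutativeMonoid = isCommutativeMonoidˡ record
      { isSemigroup = record { isMagma = isMagma _⊕_ ; assoc = ⊕-assoc }
      ; identityˡ = ⊕-identityˡ
      ; comm = ⊕-comm
      }
    ; *-isCommutativeMonoid = isCommutativeMonoidˡ record
      { isSemigroup = record { isMagma = isMagma _⊗_ ; assoc = ⊗-assoc }
      ; identityˡ = ⊗-identityˡ
      ; comm = ⊗-comm
      }
    ; distribʳ = ⊗-distribʳ-⊕
    ; zeroˡ = ⊗-zeroˡ
    }
  }

open CommutativeSemiring Z8-commutativeSemiring
  using (semiring; *-commutativeMonoid; +-rawMonoid; +-commutativeSemigroup)
open import Algebra.Properties.CommutativeSemigroup +-commutativeSemigroup using (interchange)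
open import Algebra.Definitions.RawMonoid +-rawMonoid using () renaming (_×_ to _times_)
open import Algebra.Properties.Semiring.Sum semiring
  using (sum; sum-cong-≗; ∑-distrib-+; *-distribˡ-sum; sum-permute)
open import Algebra.Properties.CommutativeMonoid.Sum *-commutativeMonoid
  using () renaming (sum to product; sum-permute to product-permute; sum-remove to product-remove)

toℕ-lit : ∀ k → toℕ (lit k) ≡ k % 8
toℕ-lit k = toℕ-fromℕ< (m%n<n k 8)

lit-+ : ∀ k l → lit (k ℕ.+ l) ≡ lit k ⊕ lit l
lit-+ k l = toℕ-injective (begin
  toℕ (lit (k ℕ.+ l))                ≡⟨ toℕ-lit (k ℕ.+ l) ⟩
  (k ℕ.+ l) % 8                      ≡⟨ %-distribˡ-+ k l 8 ⟩
  (k % 8 ℕ.+ l % 8) % 8              ≡⟨ cong₂ (λ a b → (a ℕ.+ b) % 8) (toℕ-lit k) (toℕ-lit l) ⟨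
  (toℕ (lit k) ℕ.+ toℕ (lit l)) % 8  ≡⟨ toℕ-lit (toℕ (lit k) ℕ.+ toℕ (lit l)) ⟨
  toℕ (lit k ⊕ lit l)                ∎)
  where open ≡-Reasoning

parity half : Z8 → Z8
parity w = lit (toℕ w % 2)
half   w = lit (toℕ w / 2)

⊗-parity-split : ∀ w y → w ⊗ y ≡ half w ⊗ (y ⊕ y) ⊕ parity w ⊗ y
⊗-parity-split = from-yes (all? λ w → all? λ y → w ⊗ y ≟ half w ⊗ (y ⊕ y) ⊕ parity w ⊗ y)

parity-lit : ∀ k → parity (lit k) ≡ lit (k % 2)
parity-lit k = cong lit (trans (cong (_% 2) (toℕ-lit k)) (m∣n⇒o%n%m≡o%m 2 8 k (divides 4 refl)))

parity-bit : ∀ w → parity w ≡ lit 0 ⊎ parity w ≡ lit 1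
parity-bit = from-yes (all? λ w → parity w ≟ lit 0 ⊎-dec parity w ≟ lit 1)

transpose-matchˡ : ∀ {n} (i j : Fin n) → transpose i j ⟨$⟩ʳ i ≡ j
transpose-matchˡ i j rewrite dec-true (i ≟ i) refl = refl

transpose-matchʳ : ∀ {n} (i j : Fin n) → transpose i j ⟨$⟩ʳ j ≡ i
transpose-matchʳ i j with j ≟ i
... | yes refl = refl
... | no  j≢i  rewrite dec-true (j ≟ j) refl = refl

transpose-noMatch : ∀ {n} {i j k : Fin n} → k ≢ i → k ≢ j → transpose i j ⟨$⟩ʳ k ≡ k
transpose-noMatch {i = i} {j} {k} k≢i k≢j
  rewrite dec-false (k ≟ i) k≢i | dec-false (k ≟ j) k≢j = refl

⟨$⟩ʳ-injective : ∀ {n} (π : Permutation′ n) {i j} → π ⟨$⟩ʳ i ≡ π ⟨$⟩ʳ j → i ≡ j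
⟨$⟩ʳ-injective π {i} {j} eq = trans (sym (inverseˡ π)) (trans (cong (π ⟨$⟩ˡ_) eq) (inverseˡ π))

Σ≡sum : ∀ {n} (f : Fin n → Z8) → Σ[ f ] ≡ sum f
Σ≡sum {zero}  f = refl
Σ≡sum {suc n} f = cong (f zero ⊕_) (Σ≡sum (λ i → f (suc i)))

Π≡product : ∀ {n} (f : Fin n → Z8) → Π[ f ] ≡ product f
Π≡product {zero}  f = refl
Π≡product {suc n} f = cong (f zero ⊗_) (Π≡product (λ i → f (suc i)))

Σ-⊕ : ∀ {n} (f g : Fin n → Z8) → Σ[ (λ i → f i ⊕ g i) ] ≡ Σ[ f ] ⊕ Σ[ g ]
Σ-⊕ f g rewrite Σ≡sum (λ i → f i ⊕ g i) | Σ≡sum f | Σ≡sum g = ∑-distrib-+ f g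

Σ-scale : ∀ {n} z (f : Fin n → Z8) → Σ[ (λ i → z ⊗ f i) ] ≡ z ⊗ Σ[ f ]
Σ-scale z f rewrite Σ≡sum (λ i → z ⊗ f i) | Σ≡sum f = sym (*-distribˡ-sum z f)

Σ-cong : ∀ {n} {f g : Fin n → Z8} → (∀ i → f i ≡ g i) → Σ[ f ] ≡ Σ[ g ]
Σ-cong {f = f} {g} f≗g rewrite Σ≡sum f | Σ≡sum g = sum-cong-≗ f≗g

Σ-permute : ∀ {n} (π : Permutation′ n) (f : Fin n → Z8) → Σ[ (λ i → f (π ⟨$⟩ʳ i)) ] ≡ Σ[ f ]
Σ-permute π f rewrite Σ≡sum (λ i → f (π ⟨$⟩ʳ i)) | Σ≡sum f = sym (sum-permute f π)

Π-permute : ∀ {n} (π : Permutation′ n) (f : Fin n → Z8) → Π[ (λ i → f (π ⟨$⟩ʳ i)) ] ≡ Π[ f ]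
Π-permute π f rewrite Π≡product (λ i → f (π ⟨$⟩ʳ i)) | Π≡product f = sym (product-permute f π)

Π-remove : ∀ {n} (x : Fin (suc n) → Z8) j → Π[ x ] ≡ x j ⊗ product (removeAt x j)
Π-remove x j rewrite Π≡product x = product-remove {i = j} x

Π-scaleAt : ∀ {n} (x : Fin n → Z8) j z → Π[ updateAt x j (z ⊗_) ] ≡ z ⊗ Π[ x ]
Π-scaleAt x zero    z = ⊗-assoc z (x zero) _
Π-scaleAt x (suc j) z = trans
  (cong (x zero ⊗_) (Π-scaleAt (λ i → x (suc i)) j z))
  (from-yes (all? λ a → all? λ b → all? λ c → a ⊗ (b ⊗ c) ≟ b ⊗ (a ⊗ c)) (x zero) z _)

Σ-annihilate : ∀ {n} (f : Fin n → Z8) → Σ[ (λ i → lit 0 ⊗ f i) ] ≡ lit 0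
Σ-annihilate f = trans (Σ-scale (lit 0) f) (⊗-zeroˡ Σ[ f ])

unit : ∀ {n} → Fin n → Fin n → Z8
unit j = updateAt (λ _ → lit 0) j (λ _ → lit 1)

Σ-unit : ∀ {n} j (x : Fin n → Z8) → Σ[ (λ i → unit j i ⊗ x i) ] ≡ x j
Σ-unit zero    x = trans
  (cong (lit 1 ⊗ x zero ⊕_) (Σ-annihilate (λ i → x (suc i))))
  (from-yes (all? λ a → lit 1 ⊗ a ⊕ lit 0 ≟ a) (x zero))
Σ-unit (suc j) x = trans
  (cong (lit 0 ⊗ x zero ⊕_) (Σ-unit j (λ i → x (suc i))))
  (from-yes (all? λ a → all? λ b → lit 0 ⊗ a ⊕ b ≟ b) (x zero) (x (suc j)))

Σ-difference : ∀ {n} (a b x : Fin n → Z8) →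
  Σ[ (λ i → (a i ⊕ lit 7 ⊗ b i) ⊗ x i) ] ≡ Σ[ (λ i → a i ⊗ x i) ] ⊕ lit 7 ⊗ Σ[ (λ i → b i ⊗ x i) ]
Σ-difference a b x = begin
  Σ[ (λ i → (a i ⊕ lit 7 ⊗ b i) ⊗ x i) ]
    ≡⟨ Σ-cong (λ i → from-yes (all? λ a → all? λ b → all? λ y →
         (a ⊕ lit 7 ⊗ b) ⊗ y ≟ a ⊗ y ⊕ lit 7 ⊗ (b ⊗ y)) (a i) (b i) (x i)) ⟩
  Σ[ (λ i → a i ⊗ x i ⊕ lit 7 ⊗ (b i ⊗ x i)) ]
    ≡⟨ Σ-⊕ (λ i → a i ⊗ x i) (λ i → lit 7 ⊗ (b i ⊗ x i)) ⟩
  Σ[ (λ i → a i ⊗ x i) ] ⊕ Σ[ (λ i → lit 7 ⊗ (b i ⊗ x i)) ]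
    ≡⟨ cong (Σ[ (λ i → a i ⊗ x i) ] ⊕_) (Σ-scale (lit 7) (λ i → b i ⊗ x i)) ⟩
  Σ[ (λ i → a i ⊗ x i) ] ⊕ lit 7 ⊗ Σ[ (λ i → b i ⊗ x i) ]
    ∎
  where open ≡-Reasoning

Σ-bit : ∀ {n} (b : Fin n → Bool) → Σ[ (λ i → bit (b i)) ] ≡ lit (count b)
Σ-bit {zero}  b = refl
Σ-bit {suc n} b with b zero
... | true  = trans (cong (lit 1 ⊕_) (Σ-bit (λ i → b (suc i))))
                    (sym (lit-+ 1 (count (λ i → b (suc i)))))
... | false = trans (cong (lit 0 ⊕_) (Σ-bit (λ i → b (suc i)))) (⊕-identityˡ _)

distinct-coefficients : ∀ {n} (β : Fin n → Z8) {j l} → β j ≡ lit 1 → β l ≡ lit 0 → j ≢ l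
distinct-coefficients β βj≡1 βl≡0 refl with trans (sym βj≡1) βl≡0
... | ()

Σ-transpose-difference : ∀ {n} (β x : Fin n → Z8) {j l} → β j ≡ lit 1 → β l ≡ lit 0 →
  Σ[ (λ i → β i ⊗ x i) ] ⊕ lit 7 ⊗ Σ[ (λ i → β i ⊗ x (transpose j l ⟨$⟩ʳ i)) ] ≡ x j ⊕ lit 7 ⊗ x l
Σ-transpose-difference {n} β x {j} {l} βj≡1 βl≡0 = begin
  Σ[ (λ i → β i ⊗ x i) ] ⊕ lit 7 ⊗ Σ[ (λ i → β i ⊗ x (τ ⟨$⟩ʳ i)) ]
    ≡⟨ cong (λ y → Σ[ (λ i → β i ⊗ x i) ] ⊕ lit 7 ⊗ y) moved ⟩
  Σ[ (λ i → β i ⊗ x i) ] ⊕ lit 7 ⊗ Σ[ (λ i → β (τ ⟨$⟩ˡ i) ⊗ x i) ]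
    ≡⟨ Σ-difference β (λ i → β (τ ⟨$⟩ˡ i)) x ⟨
  Σ[ (λ i → (β i ⊕ lit 7 ⊗ β (τ ⟨$⟩ˡ i)) ⊗ x i) ]
    ≡⟨ Σ-cong (λ i → cong (_⊗ x i) (coefficient i)) ⟩
  Σ[ (λ i → (unit j i ⊕ lit 7 ⊗ unit l i) ⊗ x i) ]
    ≡⟨ Σ-difference (unit j) (unit l) x ⟩
  Σ[ (λ i → unit j i ⊗ x i) ] ⊕ lit 7 ⊗ Σ[ (λ i → unit l i ⊗ x i) ]
    ≡⟨ cong₂ (λ a b → a ⊕ lit 7 ⊗ b) (Σ-unit j x) (Σ-unit l x) ⟩
  x j ⊕ lit 7 ⊗ x l
    ∎
  where
  open ≡-Reasoning
  τ : Permutation′ n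
  τ = transpose j l
  j≢l : j ≢ l
  j≢l = distinct-coefficients β βj≡1 βl≡0

  moved : Σ[ (λ i → β i ⊗ x (τ ⟨$⟩ʳ i)) ] ≡ Σ[ (λ i → β (τ ⟨$⟩ˡ i) ⊗ x i) ]
  moved = trans (Σ-cong (λ i → cong (λ k → β k ⊗ x (τ ⟨$⟩ʳ i)) (sym (inverseˡ τ))))
                (Σ-permute τ (λ i → β (τ ⟨$⟩ˡ i) ⊗ x i))

  K : Z8 → Z8 → Z8
  K a b = a ⊕ lit 7 ⊗ b

  coefficient-cases : ∀ i → Dec (i ≡ j) → Dec (i ≡ l) →
                      K (β i) (β (τ ⟨$⟩ˡ i)) ≡ K (unit j i) (unit l i)
  coefficient-cases i (yes i≡j) _ = trans
    (cong₂ K (trans (cong β i≡j) βj≡1) (trans (cong (λ k → β (τ ⟨$⟩ˡ k)) i≡j)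
                                              (trans (cong β (transpose-matchʳ l j)) βl≡0)))
    (sym (cong₂ K (trans (cong (unit j) i≡j) (updateAt-updates j _))
                  (updateAt-minimal i l _ (λ i≡l → j≢l (trans (sym i≡j) i≡l)))))
  coefficient-cases i (no i≢j) (yes i≡l) = trans
    (cong₂ K (trans (cong β i≡l) βl≡0) (trans (cong (λ k → β (τ ⟨$⟩ˡ k)) i≡l)
                                              (trans (cong β (transpose-matchˡ l j)) βj≡1)))
    (sym (cong₂ K (updateAt-minimal i j _ i≢j) (trans (cong (unit l) i≡l) (updateAt-updates l _))))
  coefficient-cases i (no i≢j) (no i≢l) = trans
    (cong (λ k → K (β i) (β k)) (transpose-noMatch i≢l i≢j))
    (trans (from-yes (all? λ b → K b b ≟ K (lit 0) (lit 0)) (β i))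
           (sym (cong₂ K (updateAt-minimal i j _ i≢j) (updateAt-minimal i l _ i≢l))))

  coefficient : ∀ i → K (β i) (β (τ ⟨$⟩ˡ i)) ≡ K (unit j i) (unit l i)
  coefficient i = coefficient-cases i (i ≟ j) (i ≟ l)

-- Clones

_⊆_ : OpSet → OpSet → Set
A ⊆ B = ∀ {m} {f : Op m} → A m f → B m f

⊆-antisym : ∀ {A B} → A ⊆ B → B ⊆ A → A ≐ B
⊆-antisym A⊆B B⊆A m f = A⊆B , B⊆A

⟨⟩-least : ∀ {S T} → S ⊆ ⟨ T ⟩ → ⟨ S ⟩ ⊆ ⟨ T ⟩
⟨⟩-least S⊆T (gen f∈)      = S⊆T f∈
⟨⟩-least S⊆T (proj i)      = proj i
⟨⟩-least S⊆T (comp f∈ gs∈) = comp (⟨⟩-least S⊆T f∈) (λ i → ⟨⟩-least S⊆T (gs∈ i))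
⟨⟩-least S⊆T (ext f≗g g∈)  = ext f≗g (⟨⟩-least S⊆T g∈)

∨-least : ∀ {A B T} → A ⊆ ⟨ T ⟩ → B ⊆ ⟨ T ⟩ → (A ∨ B) ⊆ ⟨ T ⟩
∨-least A⊆T B⊆T = ⟨⟩-least [ A⊆T , B⊆T ]

rename-closed : ∀ {S k m} {g : Op m} (σ : Fin m → Fin k) →
                ⟨ S ⟩ m g → ⟨ S ⟩ k (λ x → g (λ i → x (σ i)))
rename-closed σ g∈ = comp g∈ (λ i → proj (σ i))

record GeneratesAffine (S : OpSet) : Set₁ where
  field
    addition  : ⟨ S ⟩ 2 addOp
    constants : ∀ c → ⟨ S ⟩ 1 (λ _ → c)

C-affine : ∀ {n} (g : Op n) → GeneratesAffine (GensC g)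
C-affine g = record { addition = gen isAdd ; constants = λ c → gen (isConst c) }

∨-affine : ∀ {n} (g : Op n) (B : OpSet) → GeneratesAffine (λ m f → C g m f ⊎ B m f)
∨-affine g B = record
  { addition  = gen (inj₁ (gen isAdd))
  ; constants = λ c → gen (inj₁ (gen (isConst c)))
  }

C-least : ∀ {S} → GeneratesAffine S → ∀ {n} {g : Op n} → ⟨ S ⟩ n g → C g ⊆ ⟨ S ⟩
C-least {S} aff {g = g} g∈ = ⟨⟩-least generator
  where
  generator : GensC g ⊆ ⟨ S ⟩
  generator isG         = g∈
  generator isAdd       = GeneratesAffine.addition aff
  generator (isConst c) = GeneratesAffine.constants aff c

C-≐ : ∀ {n} {f g : Op n} → C g n f → C f n g → C f ≐ C g
C-≐ {f = f} {g} f∈ g∈ = ⊆-antisym (C-least (C-affine g) f∈) (C-least (C-affine f) g∈)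

⊗-as-times : ∀ z y → z ⊗ y ≡ toℕ z times y
⊗-as-times = from-yes (all? λ z → all? λ y → z ⊗ y ≟ toℕ z times y)

module Closure {S : OpSet} (aff : GeneratesAffine S) where
  open GeneratesAffine aff

  ⊕-closed : ∀ {m} {f g : Op m} → ⟨ S ⟩ m f → ⟨ S ⟩ m g → ⟨ S ⟩ m (λ x → f x ⊕ g x)
  ⊕-closed {f = f} {g} f∈ g∈ = comp {gs = f ∷ g ∷ []} addition λ { zero → f∈ ; (suc zero) → g∈ }

  const-closed : ∀ {m} c → ⟨ S ⟩ (suc m) (λ _ → c)
  const-closed c = comp (constants c) (λ _ → proj zero)

  times-closed : ∀ {m} {g : Op (suc m)} k → ⟨ S ⟩ (suc m) g → ⟨ S ⟩ (suc m) (λ x → k times g x)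
  times-closed zero    g∈ = const-closed (lit 0)
  times-closed (suc k) g∈ = ⊕-closed g∈ (times-closed k g∈)

  scale-closed : ∀ {m} {g : Op (suc m)} z → ⟨ S ⟩ (suc m) g → ⟨ S ⟩ (suc m) (λ x → z ⊗ g x)
  scale-closed z g∈ = ext (λ x → ⊗-as-times z _) (times-closed (toℕ z) g∈)

  Σ-closed : ∀ {m k} {g : Fin k → Op (suc m)} → (∀ i → ⟨ S ⟩ (suc m) (g i)) →
             ⟨ S ⟩ (suc m) (λ x → Σ[ (λ i → g i x) ])
  Σ-closed {k = zero}  g∈ = const-closed (lit 0)
  Σ-closed {k = suc k} g∈ = ⊕-closed (g∈ zero) (Σ-closed (λ i → g∈ (suc i)))

  ⊕-cancelˡ-closed : ∀ {m} {f g h : Op (suc m)} → ⟨ S ⟩ (suc m) f → ⟨ S ⟩ (suc m) h →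
                     (∀ x → h x ≡ f x ⊕ g x) → ⟨ S ⟩ (suc m) g
  ⊕-cancelˡ-closed {f = f} {g} {h} f∈ h∈ h≗f⊕g = ext g≗h-f (⊕-closed h∈ (scale-closed (lit 7) f∈))
    where
    g≗h-f : ∀ x → g x ≡ h x ⊕ lit 7 ⊗ f x
    g≗h-f x = trans (from-yes (all? λ a → all? λ b → b ≟ (a ⊕ b) ⊕ lit 7 ⊗ a) (f x) (g x))
                    (cong (_⊕ lit 7 ⊗ f x) (sym (h≗f⊕g x)))

  scaleAt-closed : ∀ {m} {g : Op (suc m)} j z →
                   ⟨ S ⟩ (suc m) g → ⟨ S ⟩ (suc m) (λ x → g (updateAt x j (z ⊗_)))
  scaleAt-closed {m} j z g∈ = comp g∈ coordinate
    where
    coordinate : ∀ i → ⟨ S ⟩ (suc m) (λ x → updateAt x j (z ⊗_) i)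
    coordinate i with i ≟ j
    ... | yes refl = ext (λ x → updateAt-updates i x) (scale-closed z (proj i))
    ... | no  i≢j  = ext (λ x → updateAt-minimal i j x i≢j) (proj i)

-- Operations of the form 2x₁⋯xₙ·ℓ(x) with ℓ affine

F : ∀ {n} → Op n
F x = lit 4 ⊗ Π[ x ]

R : ∀ {n} → Op n
R {n} = twice (r n)

E U : ∀ {m} → Op (suc m)
E {m} = twice (p (suc m) (s≤s z≤n))
U {m} = twice (u (suc m) (s≤s z≤n))

V D : ∀ {n} → Fin n → Fin n → Op n
V i j x = lit 2 ⊗ (Π[ x ] ⊗ (x i ⊕ x j))
D i j x = lit 2 ⊗ (Π[ x ] ⊗ (x i ⊕ lit 7 ⊗ x j))

-- V₀₁ is 2vₙ, and lit 7 ⊗ y is −y throughout.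
V₀₁ : ∀ {m} → Op (2+ m)
V₀₁ = V zero (suc zero)

Lin : ∀ {n} → (Fin n → Z8) → Z8 → Op n
Lin β γ x = lit 2 ⊗ Π[ x ] ⊗ (Σ[ (λ i → β i ⊗ x i) ] ⊕ γ)

Comb : ∀ {m} → (Fin (suc m) → Z8) → Z8 → Op (suc m)
Comb β z x = Σ[ (λ i → β i ⊗ D i zero x) ] ⊕ z ⊗ F x

-- 4a² = 4a in ℤ₈, as a² ≡ a (mod 2).

F-absorb : ∀ {m} (x : Fin (suc m) → Z8) j → lit 4 ⊗ (x j ⊗ Π[ x ]) ≡ F x
F-absorb x j rewrite Π-remove x j =
  from-yes (all? λ a → all? λ q → lit 4 ⊗ (a ⊗ (a ⊗ q)) ≟ lit 4 ⊗ (a ⊗ q)) (x j) _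

scaleAt-view : ∀ {n} (h : Z8 → Z8 → Z8 → Z8) {j k : Fin n} → k ≢ j → ∀ z x →
  h Π[ updateAt x j (z ⊗_) ] (updateAt x j (z ⊗_) j) (updateAt x j (z ⊗_) k)
    ≡ h (z ⊗ Π[ x ]) (z ⊗ x j) (x k)
scaleAt-view h {j} {k} k≢j z x
  rewrite Π-scaleAt x j z | updateAt-updates j {z ⊗_} x | updateAt-minimal k j {z ⊗_} x k≢j = refl

-- Substituting 3xⱼ for xⱼ and multiplying by 3 = 3⁻¹ exchanges V i j and D i j, as 2·3 ≡ −2 (mod 8).
V-via-D : ∀ {n} {i j : Fin n} → i ≢ j → ∀ x → V i j x ≡ lit 3 ⊗ D i j (updateAt x j (lit 3 ⊗_))
V-via-D {i = i} {j} i≢j x = trans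
  (from-yes (all? λ P → all? λ a → all? λ b →
     lit 2 ⊗ (P ⊗ (a ⊕ b)) ≟ lit 3 ⊗ (lit 2 ⊗ ((lit 3 ⊗ P) ⊗ (a ⊕ lit 7 ⊗ (lit 3 ⊗ b)))))
   Π[ x ] (x i) (x j))
  (sym (scaleAt-view (λ P b a → lit 3 ⊗ (lit 2 ⊗ (P ⊗ (a ⊕ lit 7 ⊗ b)))) i≢j (lit 3) x))

D-via-V : ∀ {n} {i j : Fin n} → i ≢ j → ∀ x → D i j x ≡ lit 3 ⊗ V i j (updateAt x j (lit 3 ⊗_))
D-via-V {i = i} {j} i≢j x = trans
  (from-yes (all? λ P → all? λ a → all? λ b →
     lit 2 ⊗ (P ⊗ (a ⊕ lit 7 ⊗ b)) ≟ lit 3 ⊗ (lit 2 ⊗ ((lit 3 ⊗ P) ⊗ (a ⊕ lit 3 ⊗ b))))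
   Π[ x ] (x i) (x j))
  (sym (scaleAt-view (λ P b a → lit 3 ⊗ (lit 2 ⊗ (P ⊗ (a ⊕ b)))) i≢j (lit 3) x))

E-double : ∀ {m} (x : Fin (suc m) → Z8) → E x ⊕ E x ≡ F x
E-double x = trans (from-yes (all? λ y → lit 2 ⊗ y ⊕ lit 2 ⊗ y ≟ lit 4 ⊗ y) (x zero ⊗ Π[ x ]))
                   (F-absorb x zero)

R-double : ∀ {n} (x : Fin n → Z8) → R x ⊕ R x ≡ F x
R-double x = from-yes (all? λ y → lit 2 ⊗ y ⊕ lit 2 ⊗ y ≟ lit 4 ⊗ y) Π[ x ]

Lin-decomp : ∀ {m} (β : Fin (suc m) → Z8) γ x →
             Lin β γ x ≡ (Σ[ (λ i → β i ⊗ D i zero x) ] ⊕ Σ[ β ] ⊗ E x) ⊕ γ ⊗ R x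
Lin-decomp β γ x = begin
  Q ⊗ (S ⊕ γ)
    ≡⟨ from-yes (all? λ a → all? λ b → all? λ c → a ⊗ (b ⊕ c) ≟ a ⊗ b ⊕ c ⊗ a) Q S γ ⟩
  Q ⊗ S ⊕ γ ⊗ Q
    ≡⟨ cong (_⊕ γ ⊗ Q) (from-yes (all? λ a → all? λ b → all? λ c →
         a ≟ (a ⊕ (lit 7 ⊗ b) ⊗ c) ⊕ c ⊗ b) (Q ⊗ S) (E x) Σ[ β ]) ⟩
  ((Q ⊗ S ⊕ (lit 7 ⊗ E x) ⊗ Σ[ β ]) ⊕ Σ[ β ] ⊗ E x) ⊕ γ ⊗ Q
    ≡⟨ cong (λ t → (t ⊕ Σ[ β ] ⊗ E x) ⊕ γ ⊗ Q) ΣβD ⟨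
  (Σ[ (λ i → β i ⊗ D i zero x) ] ⊕ Σ[ β ] ⊗ E x) ⊕ γ ⊗ R x
    ∎
  where
  open ≡-Reasoning
  Q S : Z8
  Q = R x
  S = Σ[ (λ i → β i ⊗ x i) ]
  ΣβD : Σ[ (λ i → β i ⊗ D i zero x) ] ≡ Q ⊗ S ⊕ (lit 7 ⊗ E x) ⊗ Σ[ β ]
  ΣβD = begin
    Σ[ (λ i → β i ⊗ D i zero x) ]
      ≡⟨ Σ-cong (λ i → from-yes (all? λ b → all? λ P → all? λ a → all? λ e →
           b ⊗ (lit 2 ⊗ (P ⊗ (a ⊕ lit 7 ⊗ e)))
             ≟ (lit 2 ⊗ P) ⊗ (b ⊗ a) ⊕ (lit 7 ⊗ (lit 2 ⊗ (e ⊗ P))) ⊗ b)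
           (β i) Π[ x ] (x i) (x zero)) ⟩
    Σ[ (λ i → Q ⊗ (β i ⊗ x i) ⊕ (lit 7 ⊗ E x) ⊗ β i) ]
      ≡⟨ Σ-⊕ (λ i → Q ⊗ (β i ⊗ x i)) (λ i → (lit 7 ⊗ E x) ⊗ β i) ⟩
    Σ[ (λ i → Q ⊗ (β i ⊗ x i)) ] ⊕ Σ[ (λ i → (lit 7 ⊗ E x) ⊗ β i) ]
      ≡⟨ cong₂ _⊕_ (Σ-scale Q (λ i → β i ⊗ x i)) (Σ-scale (lit 7 ⊗ E x) β) ⟩
    Q ⊗ S ⊕ (lit 7 ⊗ E x) ⊗ Σ[ β ]
      ∎

Lin-split : ∀ {m} (β : Fin (suc m) → Z8) γ x →
            Lin β γ x ≡ Comb β (half Σ[ β ] ⊕ half γ) x ⊕ (parity Σ[ β ] ⊗ E x ⊕ parity γ ⊗ R x)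
Lin-split β γ x = begin
  Lin β γ x
    ≡⟨ Lin-decomp β γ x ⟩
  (A ⊕ Σβ ⊗ E x) ⊕ γ ⊗ R x
    ≡⟨ cong₂ (λ a b → (A ⊕ a) ⊕ b) (split Σβ (E x) (E-double x)) (split γ (R x) (R-double x)) ⟩
  (A ⊕ (half Σβ ⊗ F x ⊕ parity Σβ ⊗ E x)) ⊕ (half γ ⊗ F x ⊕ parity γ ⊗ R x)
    ≡⟨ ⊕-assoc A (half Σβ ⊗ F x ⊕ parity Σβ ⊗ E x) (half γ ⊗ F x ⊕ parity γ ⊗ R x) ⟩
  A ⊕ ((half Σβ ⊗ F x ⊕ parity Σβ ⊗ E x) ⊕ (half γ ⊗ F x ⊕ parity γ ⊗ R x))
    ≡⟨ cong (A ⊕_) (interchange (half Σβ ⊗ F x) (parity Σβ ⊗ E x) (half γ ⊗ F x) (parity γ ⊗ R x)) ⟩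
  A ⊕ ((half Σβ ⊗ F x ⊕ half γ ⊗ F x) ⊕ T)
    ≡⟨ cong (λ t → A ⊕ (t ⊕ T)) (⊗-distribʳ-⊕ (F x) (half Σβ) (half γ)) ⟨
  A ⊕ ((half Σβ ⊕ half γ) ⊗ F x ⊕ T)
    ≡⟨ ⊕-assoc A ((half Σβ ⊕ half γ) ⊗ F x) T ⟨
  Comb β (half Σβ ⊕ half γ) x ⊕ T
    ∎
  where
  open ≡-Reasoning
  Σβ A T : Z8
  Σβ = Σ[ β ]
  A = Σ[ (λ i → β i ⊗ D i zero x) ]
  T = parity Σβ ⊗ E x ⊕ parity γ ⊗ R x
  split : ∀ w y → y ⊕ y ≡ F x → w ⊗ y ≡ half w ⊗ F x ⊕ parity w ⊗ y
  split w y y⊕y≡F = trans (⊗-parity-split w y) (cong (λ t → half w ⊗ t ⊕ parity w ⊗ y) y⊕y≡F)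

Lin-transpose-difference : ∀ {n} (β : Fin n → Z8) γ {j l} → β j ≡ lit 1 → β l ≡ lit 0 → ∀ x →
  D j l x ≡ Lin β γ x ⊕ lit 7 ⊗ Lin β γ (λ i → x (transpose j l ⟨$⟩ʳ i))
Lin-transpose-difference {n} β γ {j} {l} βj≡1 βl≡0 x = begin
  lit 2 ⊗ (Π[ x ] ⊗ (x j ⊕ lit 7 ⊗ x l))
    ≡⟨ ⊗-assoc (lit 2) Π[ x ] (x j ⊕ lit 7 ⊗ x l) ⟨
  Q ⊗ (x j ⊕ lit 7 ⊗ x l)
    ≡⟨ cong (Q ⊗_) (Σ-transpose-difference β x βj≡1 βl≡0) ⟨
  Q ⊗ (S ⊕ lit 7 ⊗ S′)
    ≡⟨ from-yes (all? λ q → all? λ a → all? λ b → all? λ c →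
         q ⊗ (a ⊕ lit 7 ⊗ b) ≟ q ⊗ (a ⊕ c) ⊕ lit 7 ⊗ (q ⊗ (b ⊕ c))) Q S S′ γ ⟩
  Q ⊗ (S ⊕ γ) ⊕ lit 7 ⊗ (Q ⊗ (S′ ⊕ γ))
    ≡⟨ cong (λ P → Q ⊗ (S ⊕ γ) ⊕ lit 7 ⊗ (lit 2 ⊗ P ⊗ (S′ ⊕ γ))) (Π-permute τ x) ⟨
  Lin β γ x ⊕ lit 7 ⊗ Lin β γ (λ i → x (τ ⟨$⟩ʳ i))
    ∎
  where
  open ≡-Reasoning
  τ : Permutation′ n
  τ = transpose j l
  Q S S′ : Z8
  Q = lit 2 ⊗ Π[ x ]
  S = Σ[ (λ i → β i ⊗ x i) ]
  S′ = Σ[ (λ i → β i ⊗ x (τ ⟨$⟩ʳ i)) ]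

V-transpose : ∀ {S n} {i j : Fin n} p q → ⟨ S ⟩ n (V i j) →
              ⟨ S ⟩ n (V (transpose p q ⟨$⟩ʳ i) (transpose p q ⟨$⟩ʳ j))
V-transpose {n = n} {i} {j} p q Vij∈ = ext moved (rename-closed (transpose p q ⟨$⟩ʳ_) Vij∈)
  where
  τ : Permutation′ n
  τ = transpose p q
  moved : ∀ x → V (τ ⟨$⟩ʳ i) (τ ⟨$⟩ʳ j) x ≡ V i j (λ k → x (τ ⟨$⟩ʳ k))
  moved x = cong (λ P → lit 2 ⊗ (P ⊗ (x (τ ⟨$⟩ʳ i) ⊕ x (τ ⟨$⟩ʳ j)))) (sym (Π-permute τ x))

V-move : ∀ {S n} {i j k l : Fin n} → i ≢ j → k ≢ l → ⟨ S ⟩ n (V i j) → ⟨ S ⟩ n (V k l)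
V-move {S} {n} {i} {j} {k} {l} i≢j k≢l Vij∈ =
  subst₂ (λ a b → ⟨ S ⟩ n (V a b)) (transpose-noMatch k≢j′ k≢l) (transpose-matchˡ j′ l)
         (V-transpose j′ l Vkj′∈)
  where
  j′ : Fin n
  j′ = transpose i k ⟨$⟩ʳ j
  Vkj′∈ : ⟨ S ⟩ n (V k j′)
  Vkj′∈ = subst (λ a → ⟨ S ⟩ n (V a j′)) (transpose-matchˡ i k) (V-transpose i k Vij∈)
  k≢j′ : k ≢ j′
  k≢j′ k≡j′ = i≢j (⟨$⟩ʳ-injective (transpose i k) (trans (transpose-matchˡ i k) k≡j′))

module _ {S : OpSet} (aff : GeneratesAffine S) where
  open Closure aff

  F-from-V : ∀ {m} → ⟨ S ⟩ (2+ m) V₀₁ → ⟨ S ⟩ (2+ m) F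
  F-from-V V∈ = ext F≗ (scaleAt-closed zero (lit 2) V∈)
    where
    F≗ : ∀ x → F x ≡ V₀₁ (updateAt x zero (lit 2 ⊗_))
    F≗ x = begin
      F x
        ≡⟨ F-absorb x (suc zero) ⟨
      lit 4 ⊗ (x (suc zero) ⊗ Π[ x ])
        ≡⟨ from-yes (all? λ a → all? λ b → all? λ P →
             lit 4 ⊗ (b ⊗ P) ≟ lit 2 ⊗ ((lit 2 ⊗ P) ⊗ (lit 2 ⊗ a ⊕ b)))
           (x zero) (x (suc zero)) Π[ x ] ⟩
      lit 2 ⊗ ((lit 2 ⊗ Π[ x ]) ⊗ (lit 2 ⊗ x zero ⊕ x (suc zero)))
        ≡⟨ cong (λ P → lit 2 ⊗ (P ⊗ (lit 2 ⊗ x zero ⊕ x (suc zero)))) (Π-scaleAt x zero (lit 2)) ⟨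
      V₀₁ (updateAt x zero (lit 2 ⊗_))
        ∎
      where open ≡-Reasoning

  D-closed : ∀ {m} → ⟨ S ⟩ (2+ m) V₀₁ → ∀ i → ⟨ S ⟩ (2+ m) (D i zero)
  D-closed V∈ i with i ≟ zero
  ... | yes refl = ext (λ x → from-yes (all? λ P → all? λ a → lit 2 ⊗ (P ⊗ (a ⊕ lit 7 ⊗ a)) ≟ lit 0)
                                Π[ x ] (x zero))
                       (const-closed (lit 0))
  ... | no  i≢0  = ext (D-via-V i≢0)
                       (scale-closed (lit 3) (scaleAt-closed zero (lit 3) (V-move (λ ()) i≢0 V∈)))

  Comb-closed : ∀ {m} → ⟨ S ⟩ (2+ m) V₀₁ → ∀ β z → ⟨ S ⟩ (2+ m) (Comb β z)
  Comb-closed V∈ β z =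
    ⊕-closed (Σ-closed (λ i → scale-closed (β i) (D-closed V∈ i))) (scale-closed z (F-from-V V∈))

  V-from-E : ∀ {m} → ⟨ S ⟩ (2+ m) E → ⟨ S ⟩ (2+ m) V₀₁
  V-from-E {m} E∈ = ext V≗ (⊕-closed E∈ (rename-closed (τ ⟨$⟩ʳ_) E∈))
    where
    τ : Permutation′ (2+ m)
    τ = transpose zero (suc zero)
    V≗ : ∀ x → V₀₁ x ≡ E x ⊕ E (λ i → x (τ ⟨$⟩ʳ i))
    V≗ x = trans
      (from-yes (all? λ P → all? λ a → all? λ b →
         lit 2 ⊗ (P ⊗ (a ⊕ b)) ≟ lit 2 ⊗ (a ⊗ P) ⊕ lit 2 ⊗ (b ⊗ P)) Π[ x ] (x zero) (x (suc zero)))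
      (cong (λ P → E x ⊕ lit 2 ⊗ (x (suc zero) ⊗ P)) (sym (Π-permute τ x)))

  V-from-U : ∀ {m} → ⟨ S ⟩ (2+ m) U → ⟨ S ⟩ (2+ m) V₀₁
  V-from-U {m} U∈ = ext V≗ (⊕-closed (⊕-closed U∈ (rename-closed (τ ⟨$⟩ʳ_) U∈)) F∈)
    where
    τ : Permutation′ (2+ m)
    τ = transpose zero (suc zero)
    F∈ : ⟨ S ⟩ _ F
    F∈ = ext F≗ (scaleAt-closed zero (lit 2) U∈)
      where
      F≗ : ∀ x → F x ≡ U (updateAt x zero (lit 2 ⊗_))
      F≗ x = trans
        (from-yes (all? λ P → all? λ a → lit 4 ⊗ P ≟ lit 2 ⊗ ((lit 2 ⊗ P) ⊗ (lit 2 ⊗ a ⊕ lit 1)))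
          Π[ x ] (x zero))
        (cong (λ P → lit 2 ⊗ (P ⊗ (lit 2 ⊗ x zero ⊕ lit 1))) (sym (Π-scaleAt x zero (lit 2))))
    V≗ : ∀ x → V₀₁ x ≡ (U x ⊕ U (λ i → x (τ ⟨$⟩ʳ i))) ⊕ F x
    V≗ x = trans
      (from-yes (all? λ P → all? λ a → all? λ b →
         lit 2 ⊗ (P ⊗ (a ⊕ b))
           ≟ (lit 2 ⊗ (P ⊗ (a ⊕ lit 1)) ⊕ lit 2 ⊗ (P ⊗ (b ⊕ lit 1))) ⊕ lit 4 ⊗ P)
       Π[ x ] (x zero) (x (suc zero)))
      (cong (λ P → (U x ⊕ lit 2 ⊗ (P ⊗ (x (suc zero) ⊕ lit 1))) ⊕ F x) (sym (Π-permute τ x)))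

  V-from-Lin : ∀ {m} (β : Fin (2+ m) → Z8) γ {j l} → β j ≡ lit 1 → β l ≡ lit 0 →
               ⟨ S ⟩ (2+ m) (Lin β γ) → ⟨ S ⟩ (2+ m) V₀₁
  V-from-Lin β γ {j} {l} βj≡1 βl≡0 Lin∈ = V-move j≢l (λ ()) Vjl∈
    where
    j≢l : j ≢ l
    j≢l = distinct-coefficients β βj≡1 βl≡0
    Djl∈ : ⟨ S ⟩ _ (D j l)
    Djl∈ = ext (Lin-transpose-difference β γ βj≡1 βl≡0)
               (⊕-closed Lin∈ (scale-closed (lit 7) (rename-closed (transpose j l ⟨$⟩ʳ_) Lin∈)))
    Vjl∈ : ⟨ S ⟩ _ (V j l)
    Vjl∈ = ext (V-via-D j≢l) (scale-closed (lit 3) (scaleAt-closed l (lit 3) Djl∈))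

module _ {m} {f : Op (2+ m)} (V∈f : C f (2+ m) V₀₁) (β : Fin (2+ m) → Z8) (z : Z8) where

  C-≐-Comb : (∀ x → f x ≡ Comb β z x) → C f ≐ C V₀₁
  C-≐-Comb f≗ = C-≐ (ext f≗ (Comb-closed (C-affine _) (gen isG) β z)) V∈f

  C-≐-Comb-⊕ : ∀ {g : Op (2+ m)} → C g (2+ m) V₀₁ →
               (∀ x → f x ≡ Comb β z x ⊕ g x) → C f ≐ C g
  C-≐-Comb-⊕ {g} V∈g f≗ = C-≐
    (ext f≗ (Closure.⊕-closed (C-affine g) (Comb-closed (C-affine g) V∈g β z) (gen isG)))
    (Closure.⊕-cancelˡ-closed (C-affine f) (Comb-closed (C-affine f) V∈f β z) (gen isG) f≗)

  C-≐-Comb-⊕-R : (∀ x → f x ≡ Comb β z x ⊕ R x) → C f ≐ (C V₀₁ ∨ C R)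
  C-≐-Comb-⊕-R f≗ = ⊆-antisym
    (C-least join-affine (ext f≗ (Closure.⊕-closed join-affine
      (Comb-closed join-affine (gen (inj₁ (gen isG))) β z) (gen (inj₂ (gen isG))))))
    (∨-least (C-least (C-affine f) V∈f) (C-least (C-affine f) R∈f))
    where
    join-affine : GeneratesAffine (λ k g → C V₀₁ k g ⊎ C R k g)
    join-affine = ∨-affine V₀₁ (C R)
    R∈f : C f (2+ m) R
    R∈f = Closure.⊕-cancelˡ-closed (C-affine f) (Comb-closed (C-affine f) V∈f β z) (gen isG) f≗

module _ {m} (β : Fin (2+ m) → Z8) (γ : Z8) {f : Op (2+ m)} (f≗Lin : ∀ x → f x ≡ Lin β γ x)
         {j l} (βj≡1 : β j ≡ lit 1) (βl≡0 : β l ≡ lit 0) where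

  z : Z8
  z = half Σ[ β ] ⊕ half γ

  V∈C-Lin : C f (2+ m) V₀₁
  V∈C-Lin = V-from-Lin (C-affine f) β γ βj≡1 βl≡0 (ext (λ x → sym (f≗Lin x)) (gen isG))

  Lin-shape : ∀ {ε δ} → parity Σ[ β ] ≡ ε → parity γ ≡ δ →
              ∀ x → f x ≡ Comb β z x ⊕ (ε ⊗ E x ⊕ δ ⊗ R x)
  Lin-shape refl refl x = trans (f≗Lin x) (Lin-split β γ x)

  C-Lin-even : parity Σ[ β ] ≡ lit 0 →
               (C f ≐ C V₀₁) ⊎ (C f ≐ (C V₀₁ ∨ C R))
  C-Lin-even ε≡0 = ⊎-map
    (λ δ≡0 → C-≐-Comb V∈C-Lin β z λ x → trans (Lin-shape ε≡0 δ≡0 x)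
       (from-yes (all? λ c → all? λ e → all? λ ρ → c ⊕ (lit 0 ⊗ e ⊕ lit 0 ⊗ ρ) ≟ c)
         (Comb β z x) (E x) (R x)))
    (λ δ≡1 → C-≐-Comb-⊕-R V∈C-Lin β z λ x → trans (Lin-shape ε≡0 δ≡1 x)
       (cong (Comb β z x ⊕_)
         (from-yes (all? λ e → all? λ ρ → lit 0 ⊗ e ⊕ lit 1 ⊗ ρ ≟ ρ) (E x) (R x))))
    (parity-bit γ)

  C-Lin-odd : parity Σ[ β ] ≡ lit 1 → (C f ≐ C U) ⊎ (C f ≐ C E)
  C-Lin-odd ε≡1 = ⊎-swap (⊎-map
    (λ δ≡0 → C-≐-Comb-⊕ V∈C-Lin β z (V-from-E (C-affine E) (gen isG)) λ x →
       trans (Lin-shape ε≡1 δ≡0 x) (cong (Comb β z x ⊕_)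
         (from-yes (all? λ e → all? λ ρ → lit 1 ⊗ e ⊕ lit 0 ⊗ ρ ≟ e) (E x) (R x))))
    (λ δ≡1 → C-≐-Comb-⊕ V∈C-Lin β z (V-from-U (C-affine U) (gen isG)) λ x →
       trans (Lin-shape ε≡1 δ≡1 x) (cong (Comb β z x ⊕_)
         (from-yes (all? λ a → all? λ P →
            lit 1 ⊗ (lit 2 ⊗ (a ⊗ P)) ⊕ lit 1 ⊗ (lit 2 ⊗ P) ≟ lit 2 ⊗ (P ⊗ (a ⊕ lit 1)))
          (x zero) Π[ x ])))
    (parity-bit γ))

-- The operations of 𝒢₁

G1op-Lin : ∀ {n} (a b : Fin n → Bool) c → (∀ i → a i ≡ false) →
           ∀ x → G1op n a b c x ≡ Lin (λ i → bit (b i)) (lit (toℕ c)) x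
G1op-Lin a b c a≡false x =
  cong (λ y → lit 2 ⊗ Π[ x ] ⊗ (y ⊕ lit (toℕ c))) (trans (cong (_⊕ Σb) Σa≡0) (⊕-identityˡ Σb))
  where
  Σb : Z8
  Σb = Σ[ (λ i → bit (b i) ⊗ x i) ]
  Σa≡0 : Σ[ (λ i → bit (a i) ⊗ x i ⊗ x i) ] ≡ lit 0
  Σa≡0 = trans
    (Σ-cong (λ i → trans (cong (λ a → bit a ⊗ x i ⊗ x i) (a≡false i)) (⊗-assoc (lit 0) (x i) (x i))))
    (Σ-annihilate (λ i → x i ⊗ x i))

parity-count : ∀ {n} (b : Fin n → Bool) → parity Σ[ (λ i → bit (b i)) ] ≡ lit (count b % 2)
parity-count b = trans (cong parity (Σ-bit b)) (parity-lit (count b))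

count<⇒∃false : ∀ {n} (b : Fin n → Bool) → count b < n → ∃ λ l → b l ≡ false
count<⇒∃false {suc n} b count<n with b zero in b0≡
... | false = zero , b0≡
... | true with count<⇒∃false (λ i → b (suc i)) (ℕ.s<s⁻¹ count<n)
...   | l , bl≡false = suc l , bl≡false

G1-clones : ∀ {n} (h : 2 ≤ n) (n≥1 : 1 ≤ n) (a b : Fin n → Bool) c → (∀ i → a i ≡ false) →
  (∃ λ j → b j ≡ true) → count b < n →
  C (G1op n a b c) n (twice (v n h))
  × (count b % 2 ≡ 0 → (C (G1op n a b c) ≐ C (twice (v n h)))
                       ⊎ (C (G1op n a b c) ≐ (C (twice (v n h)) ∨ C (twice (r n)))))
  × (count b % 2 ≡ 1 → (C (G1op n a b c) ≐ C (twice (u n n≥1)))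
                       ⊎ (C (G1op n a b c) ≐ C (twice (p n n≥1))))
G1-clones (s≤s (s≤s z≤n)) (s≤s z≤n) a b c a≡false (j , bj≡true) count<n =
  V∈C-Lin β γ f≗Lin βj≡1 βl≡0 ,
  (λ even → C-Lin-even β γ f≗Lin βj≡1 βl≡0 (trans (parity-count b) (cong lit even))) ,
  (λ odd → C-Lin-odd β γ f≗Lin βj≡1 βl≡0 (trans (parity-count b) (cong lit odd)))
  where
  β : Fin _ → Z8
  β i = bit (b i)
  γ : Z8
  γ = lit (toℕ c)
  f≗Lin : ∀ x → G1op _ a b c x ≡ Lin β γ x
  f≗Lin = G1op-Lin a b c a≡false
  βj≡1 : β j ≡ lit 1
  βj≡1 = cong bit bj≡true
  l : Fin _
  l = proj₁ (count<⇒∃false b count<n)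
  βl≡0 : β l ≡ lit 0
  βl≡0 = cong bit (proj₂ (count<⇒∃false b count<n))

G1-all-K : ∀ {n} (a b : Fin n → Bool) c → (∀ i → a i ≡ false) → (∀ i → b i ≡ true) →
           ∀ x → G1op n a b c x ≡ lit 2 ⊗ (Π[ x ] ⊗ (Σ[ x ] ⊕ lit (toℕ c)))
G1-all-K a b c a≡false b≡true x = trans (G1op-Lin a b c a≡false x) (trans
  (cong (λ y → lit 2 ⊗ Π[ x ] ⊗ (y ⊕ lit (toℕ c)))
        (Σ-cong (λ i → trans (cong (λ b → bit b ⊗ x i) (b≡true i)) (⊗-identityˡ (x i)))))
  (⊗-assoc (lit 2) Π[ x ] (Σ[ x ] ⊕ lit (toℕ c))))

t-or-s-constant : ∀ B (e : Z8) → e ≡ lit 0 ⊎ e ≡ lit 1 →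
                  e ≡ (if B then lit 0 else lit 1) ⊎ e ≡ (if B then lit 1 else lit 0)
t-or-s-constant true  e (inj₁ e≡0) = inj₁ e≡0
t-or-s-constant true  e (inj₂ e≡1) = inj₂ e≡1
t-or-s-constant false e (inj₁ e≡0) = inj₂ e≡0
t-or-s-constant false e (inj₂ e≡1) = inj₁ e≡1

G1-t-or-s : ∀ {n} (a b : Fin n → Bool) c → (∀ i → a i ≡ false) → (∀ i → b i ≡ true) →
            (c ≡ lit4 0 ⊎ c ≡ lit4 1) →
            (∀ x → G1op n a b c x ≡ twice (t n) x) ⊎ (∀ x → G1op n a b c x ≡ twice (s n) x)
G1-t-or-s {n} a b c a≡false b≡true c≤1 =
  ⊎-map with-constant with-constant (t-or-s-constant (even n) (lit (toℕ c)) (⊎-map lit-c lit-c c≤1))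
  where
  lit-c : ∀ {d} → c ≡ d → lit (toℕ c) ≡ lit (toℕ d)
  lit-c = cong (λ d → lit (toℕ d))
  with-constant : ∀ {e} → lit (toℕ c) ≡ e → ∀ x → G1op n a b c x ≡ lit 2 ⊗ (Π[ x ] ⊗ (Σ[ x ] ⊕ e))
  with-constant c≡e x = trans (G1-all-K a b c a≡false b≡true x)
                              (cong (λ e → lit 2 ⊗ (Π[ x ] ⊗ (Σ[ x ] ⊕ e))) c≡e)

theorem4p2 : (n : ℕ) → (n≥1 : 1 ≤ n) → (a b : Fin n → Bool) → (c : Fin 4) →
    (∀ i → a i ≡ false) → ∃ (λ j → b j ≡ true) →
    -- (i)
    (((∀ i → b i ≡ true) → (c ≡ lit4 0 ⊎ c ≡ lit4 1) →
        (∀ x → G1op n a b c x ≡ twice (t n) x) ⊎ (∀ x → G1op n a b c x ≡ twice (s n) x))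
    -- (ii)
    × ((k1 : 1 ≤ count b) → (k2 : count b < n) →
        C (G1op n a b c) n (twice (v n (twoLe k1 k2))))
    -- (iii)
    × ((k1 : 1 ≤ count b) → (k2 : count b < n) → count b % 2 ≡ 0 →
        (C (G1op n a b c) ≐ C (twice (v n (twoLe k1 k2))))
        ⊎ (C (G1op n a b c) ≐ (C (twice (v n (twoLe k1 k2))) ∨ C (twice (r n)))))
    -- (iv)
    × ((k1 : 1 ≤ count b) → (k2 : count b < n) → count b % 2 ≡ 1 →
        (C (G1op n a b c) ≐ C (twice (u n n≥1)))
        ⊎ (C (G1op n a b c) ≐ C (twice (p n n≥1)))))
theorem4p2 n n≥1 a b c a≡false some-true =
  G1-t-or-s a b c a≡false ,
  (λ k1 k2 → proj₁ (G1-clones (twoLe k1 k2) n≥1 a b c a≡false some-true k2)) ,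
  (λ k1 k2 → proj₁ (proj₂ (G1-clones (twoLe k1 k2) n≥1 a b c a≡false some-true k2))) ,
  (λ k1 k2 → proj₂ (proj₂ (G1-clones (twoLe k1 k2) n≥1 a b c a≡false some-true k2)))
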